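{- For every $n\ge1$ and every rectangular permutation $\pi\in S_n$, there is exactly one pair $(\psi,\sigma)$ with $\psi\in\{\psi_1,\psi_2,\psi_u,\psi_d\}$ and $\sigma$ a rectangular permutation in $S_{n-1}$ lying in the domain of $\psi$, such that $\pi=\psi(\sigma)$.
   Context: Permutations are in one-line form; $S_0$ consists of the empty permutation $e_0$. A permutation is rectangular if it avoids each of $2413, 2431, 4213, 4231$. For $\pi\in S_n$, $1\le i,j\le n+1$, $\rho_{i,j}(\pi)\in S_{n+1}$ increases by $1$ every entry $\ge i$ and inserts the value $i$ at position $j$. $\psi_1=\rho_{1,1}$ with domain all rectangular permutations; $\psi_2=\rho_{1,2}$ with domain the rectangular $\pi$ of size $\ge2$ with $\pi_1\ne1$; $\psi_u(\pi)=\rho_{\pi_1,1}(\pi)$ with domain the rectangular $\pi$ of size $\ge2$ with $\pi_1\ne1$; $\psi_d(\pi)=\rho_{\pi_1+1,1}(\pi)$ with domain the rectangular $\pi$ of size $\ge1$. -}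

module Defs where

open import Data.Nat using (ℕ; zero; suc; _<_; _≤_; _≥_; _+_)
open import Data.Nat.Properties using (_≤?_)
open import Data.List using (List; []; _∷_; map; upTo; length)
open import Data.List.Relation.Binary.Permutation.Propositional using (_↭_)
open import Data.List.Relation.Binary.Sublist.Propositional using (_⊆_)
open import Data.List.Relation.Binary.Pointwise using (Pointwise)
open import Data.Product using (Σ; _×_; ∃)
open import Relation.Nullary using (¬_; yes; no)
open import Relation.Binary.PropositionalEquality using (_≡_; _≢_)
open import Function.Bundles using (_⇔_)

IsPerm : ℕ → List ℕ → Set
IsPerm n π = π ↭ map suc (upTo n)

-- Order-isomorphism of two sequences of distinct numbers:
-- for every pair of positions, the relative order agrees.
data OrderIso : List ℕ → List ℕ → Set where
  oi-[] : OrderIso [] []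
  oi-∷  : ∀ {x y xs ys} →
          Pointwise (λ a b → (x < a ⇔ y < b)) xs ys →
          OrderIso xs ys → OrderIso (x ∷ xs) (y ∷ ys)

Contains : List ℕ → List ℕ → Set
Contains π p = ∃ λ s → (s ⊆ π) × OrderIso s p

Avoids : List ℕ → List ℕ → Set
Avoids π p = ¬ Contains π p

Rectangular : List ℕ → Set
Rectangular π =
  Avoids π (2 ∷ 4 ∷ 1 ∷ 3 ∷ []) × Avoids π (2 ∷ 4 ∷ 3 ∷ 1 ∷ []) ×
  Avoids π (4 ∷ 2 ∷ 1 ∷ 3 ∷ []) × Avoids π (4 ∷ 2 ∷ 3 ∷ 1 ∷ [])

bump : ℕ → ℕ → ℕ
bump i x with i ≤? x
... | yes _ = suc x
... | no  _ = x

-- insert a at 0-based index k (at the end if k ≥ length)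
insertAt : ℕ → ℕ → List ℕ → List ℕ
insertAt zero    a xs       = a ∷ xs
insertAt (suc k) a []       = a ∷ []
insertAt (suc k) a (x ∷ xs) = x ∷ insertAt k a xs

-- ρ_{i,j}(π): bump entries ≥ i, insert value i at (1-based) position j.
ρ : ℕ → ℕ → List ℕ → List ℕ
ρ i j π = insertAt (j Data.Nat.∸ 1) i (map (bump i) π)

-- first entry π_1 (only used on nonempty permutations; 0 otherwise)
first : List ℕ → ℕ
first []      = 0
first (x ∷ _) = x

data Psi : Set where
  ψ₁ ψ₂ ψᵤ ψd : Psi

apply : Psi → List ℕ → List ℕ
apply ψ₁ σ = ρ 1 1 σ
apply ψ₂ σ = ρ 1 2 σ
apply ψᵤ σ = ρ (first σ) 1 σ
apply ψd σ = ρ (suc (first σ)) 1 σ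

InDomain : Psi → ℕ → List ℕ → Set
InDomain ψ₁ m σ = IsPerm m σ × Rectangular σ
InDomain ψ₂ m σ = IsPerm m σ × Rectangular σ × m ≥ 2 × first σ ≢ 1
InDomain ψᵤ m σ = IsPerm m σ × Rectangular σ × m ≥ 2 × first σ ≢ 1
InDomain ψd m σ = IsPerm m σ × Rectangular σ × m ≥ 1

-- Write π = a b ⋯. If a = 1 then π = ψ₁(σ). Otherwise rectangularity forces
-- b ∈ {a + 1, a − 1, 1}: if a, b ≥ 2 are not adjacent, then 1 and min(a, b) + 1
-- both occur after b, and together with a and b they form one of 2413, 2431,
-- 4213, 4231. The three cases are π = ψᵤ(σ), ψd(σ), ψ₂(σ), where σ is π with the
-- inserted entry deleted and the remaining values standardised; σ is rectangular
-- because it is order-isomorphic to a subsequence of π. The images of the four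
-- maps are told apart by the first two entries, from which σ is recovered; this
-- gives uniqueness.
module Submission where

open import Defs
open import Data.Empty using (⊥; ⊥-elim)
open import Data.Nat using (ℕ; suc; _∸_; _<_; _≤_; z≤n; s≤s; s≤s⁻¹; s<s; s<s⁻¹)
open import Data.Nat.Properties
open import Data.List using (List; []; _∷_; map; upTo)
open import Data.List.Membership.Propositional using (_∈_)
open import Data.List.Membership.Propositional.Properties using (∈-map⁺; ∈-map⁻; ∈-upTo⁺; ∈-upTo⁻)
open import Data.List.Membership.Propositional.Properties.WithK using (unique∧set⇒bag)
open import Data.List.Relation.Binary.BagAndSetEquality using (∼bag⇒↭)
open import Data.List.Relation.Binary.Permutation.Propositional using (↭-refl; ↭-sym; ↭-trans; swap; ↭⇒↭ₛ)
open import Data.List.Relation.Binary.Permutation.Propositional.Properties using (∈-resp-↭)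
open import Data.List.Relation.Binary.Permutation.Setoid.Properties using (Unique-resp-↭)
open import Data.List.Relation.Binary.Pointwise using (Pointwise; []; _∷_)
open import Data.List.Relation.Binary.Sublist.Propositional using (_⊆_; _∷_; _∷ʳ_; ⊆-refl; ⊆-trans; from∈)
import Data.List.Relation.Binary.Sublist.Propositional.Properties as Sublist
open import Data.List.Relation.Unary.All using (All; []; _∷_)
open import Data.List.Relation.Unary.AllPairs using (_∷_)
open import Data.List.Relation.Unary.Any using (here; there)
open import Data.List.Relation.Unary.Unique.Propositional using (Unique)
import Data.List.Relation.Unary.Unique.Propositional.Properties as Unique
open import Data.Product using (_×_; _,_; proj₁; proj₂; ∃; ∃!)
open import Data.Sum using (_⊎_; inj₁; inj₂)
open import Function using (_∘_; const)
open import Function.Bundles using (_⇔_; mk⇔)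
open import Function.Construct.Composition using (_⇔-∘_)
open import Function.Construct.Symmetry using (⇔-sym)
open import Relation.Binary.Definitions using (Tri; tri<; tri≈; tri>)
open import Relation.Binary.PropositionalEquality
open import Relation.Nullary using (¬_; yes; no)
open import Relation.Nullary.Decidable using (True; toWitness; dec-no)

private variable
  a b c i j m n x y : ℕ
  p r s τ π : List ℕ

oneTo : ℕ → List ℕ
oneTo n = map suc (upTo n)

∈-oneTo⁻ : x ∈ oneTo n → 1 ≤ x × x ≤ n
∈-oneTo⁻ x∈ with ∈-map⁻ suc x∈
... | _ , y∈ , refl = s≤s z≤n , ∈-upTo⁻ y∈

∈-oneTo⁺ : 1 ≤ x → x ≤ n → x ∈ oneTo n
∈-oneTo⁺ {suc _} _ x≤n = ∈-map⁺ suc (∈-upTo⁺ x≤n)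

oneTo-unique : ∀ n → Unique (oneTo n)
oneTo-unique n = Unique.map⁺ suc-injective (Unique.upTo⁺ n)

IsPerm-∈⁻ : IsPerm n π → x ∈ π → 1 ≤ x × x ≤ n
IsPerm-∈⁻ π↭ x∈ = ∈-oneTo⁻ (∈-resp-↭ π↭ x∈)

IsPerm-∈⁺ : IsPerm n π → 1 ≤ x → x ≤ n → x ∈ π
IsPerm-∈⁺ π↭ 1≤x x≤n = ∈-resp-↭ (↭-sym π↭) (∈-oneTo⁺ 1≤x x≤n)

IsPerm-unique : IsPerm n π → Unique π
IsPerm-unique {n} π↭ = Unique-resp-↭ (setoid ℕ) (↭⇒↭ₛ (↭-sym π↭)) (oneTo-unique n)

¬IsPerm-suc-[] : ¬ IsPerm (suc m) []
¬IsPerm-suc-[] []↭ with () ← IsPerm-∈⁺ []↭ ≤-refl (s≤s z≤n)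

bump-≥ : i ≤ x → bump i x ≡ suc x
bump-≥ {i} {x} i≤x with i ≤? x
... | yes _   = refl
... | no  i≰x = ⊥-elim (i≰x i≤x)

bump-< : x < i → bump i x ≡ x
bump-< {x} {i} x<i with i ≤? x
... | yes i≤x = ⊥-elim (<⇒≱ x<i i≤x)
... | no  _   = refl

bump-≢ : bump i x ≢ i
bump-≢ {i} {x} with i ≤? x
... | yes i≤x = <⇒≢ (s≤s i≤x) ∘ sym
... | no  i≰x = i≰x ∘ ≤-reflexive ∘ sym

bump-<-⇔ : x < y ⇔ bump i x < bump i y
bump-<-⇔ {x} {y} {i} with i ≤? x | i ≤? y
... | yes _   | yes _   = mk⇔ s<s s<s⁻¹
... | yes i≤x | no  i≰y = mk⇔ (⊥-elim ∘ i≰y ∘ i≤y) (⊥-elim ∘ i≰y ∘ i≤y ∘ <-trans (n<1+n x))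
  where i≤y : x < y → i ≤ y
        i≤y x<y = ≤-trans i≤x (<⇒≤ x<y)
... | no  i≰x | yes i≤y = mk⇔ (λ x<y → m<n⇒m<1+n x<y) (λ _ → <-≤-trans (≰⇒> i≰x) i≤y)
... | no  _   | no  _   = mk⇔ (λ x<y → x<y) (λ x<y → x<y)

bump-bounds : 1 ≤ x → x ≤ m → 1 ≤ bump i x × bump i x ≤ suc m
bump-bounds {x} {m} {i} 1≤x x≤m with i ≤? x
... | yes _ = s≤s z≤n , s≤s x≤m
... | no  _ = 1≤x , m≤n⇒m≤1+n x≤m

bump-bounds⁻ : 1 ≤ i → i ≤ suc m → 1 ≤ bump i x → bump i x ≤ suc m → 1 ≤ x × x ≤ m
bump-bounds⁻ {i} {m} {x} 1≤i i≤1+m 1≤bx bx≤1+m with i ≤? x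
... | yes i≤x = ≤-trans 1≤i i≤x , ≤-pred bx≤1+m
... | no  i≰x = 1≤bx , ≤-pred (≤-trans (≰⇒> i≰x) i≤1+m)

unbump : ℕ → ℕ → ℕ
unbump i x with i <? x
... | yes _ = x ∸ 1
... | no  _ = x

unbump-bump : ∀ i x → unbump i (bump i x) ≡ x
unbump-bump i x with i ≤? x
... | yes i≤x with i <? suc x
...   | yes _   = refl
...   | no  i≮x = ⊥-elim (i≮x (s≤s i≤x))
unbump-bump i x | no i≰x with i <? x
...   | yes i<x = ⊥-elim (i≰x (<⇒≤ i<x))
...   | no  _   = refl

bump-unbump : x ≢ i → bump i (unbump i x) ≡ x
bump-unbump {x} {i} x≢i with i <? x
bump-unbump {suc x} _   | yes i<x = bump-≥ (s≤s⁻¹ i<x)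
bump-unbump         x≢i | no  i≮x = bump-< (≤∧≢⇒< (≮⇒≥ i≮x) x≢i)

bump-injective : bump i x ≡ bump i y → x ≡ y
bump-injective {i} {x} {y} eq =
  trans (sym (unbump-bump i x)) (trans (cong (unbump i) eq) (unbump-bump i y))

unbump-suc : i ≤ x → unbump i (suc x) ≡ x
unbump-suc {i} {x} i≤x = trans (cong (unbump i) (sym (bump-≥ i≤x))) (unbump-bump i x)

unbump-< : x < i → unbump i x ≡ x
unbump-< {x} {i} x<i = trans (cong (unbump i) (sym (bump-< x<i))) (unbump-bump i x)

map-unbump-bump : ∀ i σ → map (unbump i) (map (bump i) σ) ≡ σ
map-unbump-bump i []      = refl
map-unbump-bump i (x ∷ σ) = cong₂ _∷_ (unbump-bump i x) (map-unbump-bump i σ)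

map-bump-unbump : All (i ≢_) r → map (bump i) (map (unbump i) r) ≡ r
map-bump-unbump []           = refl
map-bump-unbump (i≢x ∷ i∉r) = cong₂ _∷_ (bump-unbump (i≢x ∘ sym)) (map-bump-unbump i∉r)

tail-bump-unbump : IsPerm n (i ∷ r) → map (bump i) (map (unbump i) r) ≡ r
tail-bump-unbump π↭ with IsPerm-unique π↭
... | i∉r ∷ _ = map-bump-unbump i∉r

tail-unbump-IsPerm : IsPerm (suc m) (i ∷ r) → IsPerm m (map (unbump i) r)
tail-unbump-IsPerm {m} {i} {r} π↭ =
  ∼bag⇒↭ (unique∧set⇒bag σ-unique (oneTo-unique m) (mk⇔ to from))
  where
  σ = map (unbump i) r
  r≡ : map (bump i) σ ≡ r
  r≡ = tail-bump-unbump π↭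
  i-bounds : 1 ≤ i × i ≤ suc m
  i-bounds = IsPerm-∈⁻ π↭ (here refl)
  σ-unique : Unique σ
  σ-unique with IsPerm-unique π↭
  ... | _ ∷ r-unique = Unique.map⁻ (subst Unique (sym r≡) r-unique)
  to : y ∈ σ → y ∈ oneTo m
  to {y} y∈ with IsPerm-∈⁻ π↭ (there (subst (bump i y ∈_) r≡ (∈-map⁺ (bump i) y∈)))
  ... | 1≤by , by≤1+m with bump-bounds⁻ (proj₁ i-bounds) (proj₂ i-bounds) 1≤by by≤1+m
  ...   | 1≤y , y≤m = ∈-oneTo⁺ 1≤y y≤m
  from : y ∈ oneTo m → y ∈ σ
  from {y} y∈ with ∈-oneTo⁻ y∈
  ... | 1≤y , y≤m with bump-bounds {i = i} 1≤y y≤m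
  ...   | 1≤by , by≤1+m with IsPerm-∈⁺ π↭ 1≤by by≤1+m
  ...     | here by≡i = ⊥-elim (bump-≢ by≡i)
  ...     | there by∈r with ∈-map⁻ (bump i) (subst (bump i y ∈_) (sym r≡) by∈r)
  ...       | z , z∈ , by≡bz = subst (_∈ σ) (sym (bump-injective by≡bz)) z∈

ρ-head : IsPerm n (i ∷ r) → j ≡ i → i ∷ r ≡ ρ j 1 (map (unbump i) r)
ρ-head π↭ refl = cong (_ ∷_) (sym (tail-bump-unbump π↭))

Contains-⊆ : τ ⊆ π → Contains τ p → Contains π p
Contains-⊆ τ⊆π (s , s⊆τ , o) = s , ⊆-trans s⊆τ τ⊆π , o

module _ {f : ℕ → ℕ} (f-<-⇔ : ∀ {x y} → x < y ⇔ f x < f y) where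

  OrderIso-map : OrderIso s p → OrderIso (map f s) p
  OrderIso-map oi-[]       = oi-[]
  OrderIso-map (oi-∷ pw o) = oi-∷ (compare-map pw) (OrderIso-map o)
    where
    compare-map : ∀ {x y xs ys} → Pointwise (λ a b → (x < a ⇔ y < b)) xs ys →
                  Pointwise (λ a b → (f x < a ⇔ y < b)) (map f xs) ys
    compare-map []       = []
    compare-map (e ∷ pw) = e ⇔-∘ ⇔-sym f-<-⇔ ∷ compare-map pw

  Contains-map : Contains τ p → Contains (map f τ) p
  Contains-map (s , s⊆τ , o) = map f s , Sublist.map⁺ f s⊆τ , OrderIso-map o

  Rectangular-⊆ : map f τ ⊆ π → Rectangular π → Rectangular τ
  Rectangular-⊆ {τ = τ} {π = π} fτ⊆π (¬2413 , ¬2431 , ¬4213 , ¬4231) =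
    ¬2413 ∘ lift , ¬2431 ∘ lift , ¬4213 ∘ lift , ¬4231 ∘ lift
    where
    lift : Contains τ p → Contains π p
    lift = Contains-⊆ fτ⊆π ∘ Contains-map

Rectangular-unbump : IsPerm n (i ∷ r) → r ⊆ π → Rectangular π → Rectangular (map (unbump i) r)
Rectangular-unbump {π = π} π↭ r⊆π =
  Rectangular-⊆ bump-<-⇔ (subst (_⊆ π) (sym (tail-bump-unbump π↭)) r⊆π)

<⇔< : x < a → {y<b : True (y <? b)} → (x < a ⇔ y < b)
<⇔< x<a {y<b} = mk⇔ (const (toWitness y<b)) (const x<a)

>⇔> : a < x → {b<y : True (b <? y)} → (x < a ⇔ y < b)
>⇔> a<x {b<y} = mk⇔ (⊥-elim ∘ <-asym a<x) (⊥-elim ∘ <-asym (toWitness b<y))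

iso-2413 : x < a → a < c → c < b → OrderIso (a ∷ b ∷ x ∷ c ∷ []) (2 ∷ 4 ∷ 1 ∷ 3 ∷ [])
iso-2413 x<a a<c c<b =
  oi-∷ (<⇔< (<-trans a<c c<b) ∷ >⇔> x<a ∷ <⇔< a<c ∷ [])
  (oi-∷ (>⇔> (<-trans x<a (<-trans a<c c<b)) ∷ >⇔> c<b ∷ [])
  (oi-∷ (<⇔< (<-trans x<a a<c) ∷ []) (oi-∷ [] oi-[])))

iso-2431 : x < a → a < c → c < b → OrderIso (a ∷ b ∷ c ∷ x ∷ []) (2 ∷ 4 ∷ 3 ∷ 1 ∷ [])
iso-2431 x<a a<c c<b =
  oi-∷ (<⇔< (<-trans a<c c<b) ∷ <⇔< a<c ∷ >⇔> x<a ∷ [])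
  (oi-∷ (>⇔> c<b ∷ >⇔> (<-trans x<a (<-trans a<c c<b)) ∷ [])
  (oi-∷ (>⇔> (<-trans x<a a<c) ∷ []) (oi-∷ [] oi-[])))

iso-4213 : x < b → b < c → c < a → OrderIso (a ∷ b ∷ x ∷ c ∷ []) (4 ∷ 2 ∷ 1 ∷ 3 ∷ [])
iso-4213 x<b b<c c<a =
  oi-∷ (>⇔> (<-trans b<c c<a) ∷ >⇔> (<-trans x<b (<-trans b<c c<a)) ∷ >⇔> c<a ∷ [])
  (oi-∷ (>⇔> x<b ∷ <⇔< b<c ∷ [])
  (oi-∷ (<⇔< (<-trans x<b b<c) ∷ []) (oi-∷ [] oi-[])))

iso-4231 : x < b → b < c → c < a → OrderIso (a ∷ b ∷ c ∷ x ∷ []) (4 ∷ 2 ∷ 3 ∷ 1 ∷ [])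
iso-4231 x<b b<c c<a =
  oi-∷ (>⇔> (<-trans b<c c<a) ∷ >⇔> c<a ∷ >⇔> (<-trans x<b (<-trans b<c c<a)) ∷ [])
  (oi-∷ (<⇔< b<c ∷ >⇔> x<b ∷ [])
  (oi-∷ (>⇔> (<-trans x<b b<c) ∷ []) (oi-∷ [] oi-[])))

∈-∈⇒⊆ : x ∈ r → y ∈ r → x ≢ y → x ∷ y ∷ [] ⊆ r ⊎ y ∷ x ∷ [] ⊆ r
∈-∈⇒⊆ (here refl) (here refl) x≢y = ⊥-elim (x≢y refl)
∈-∈⇒⊆ (here refl) (there y∈)  _   = inj₁ (refl ∷ from∈ y∈)
∈-∈⇒⊆ (there x∈)  (here refl) _   = inj₂ (refl ∷ from∈ x∈)
∈-∈⇒⊆ {r = z ∷ _} (there x∈) (there y∈) x≢y with ∈-∈⇒⊆ x∈ y∈ x≢y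
... | inj₁ xy⊆ = inj₁ (z ∷ʳ xy⊆)
... | inj₂ yx⊆ = inj₂ (z ∷ʳ yx⊆)

rising-gap-⊥ : Rectangular (a ∷ b ∷ r) → x ∈ r → c ∈ r → x < a → a < c → c < b → ⊥
rising-gap-⊥ (¬2413 , ¬2431 , _) x∈ c∈ x<a a<c c<b
  with ∈-∈⇒⊆ x∈ c∈ (<⇒≢ (<-trans x<a a<c))
... | inj₁ xc⊆ = ¬2413 (_ , refl ∷ refl ∷ xc⊆ , iso-2413 x<a a<c c<b)
... | inj₂ cx⊆ = ¬2431 (_ , refl ∷ refl ∷ cx⊆ , iso-2431 x<a a<c c<b)

falling-gap-⊥ : Rectangular (a ∷ b ∷ r) → x ∈ r → c ∈ r → x < b → b < c → c < a → ⊥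
falling-gap-⊥ (_ , _ , ¬4213 , ¬4231) x∈ c∈ x<b b<c c<a
  with ∈-∈⇒⊆ x∈ c∈ (<⇒≢ (<-trans x<b b<c))
... | inj₁ xc⊆ = ¬4213 (_ , refl ∷ refl ∷ xc⊆ , iso-4213 x<b b<c c<a)
... | inj₂ cx⊆ = ¬4231 (_ , refl ∷ refl ∷ cx⊆ , iso-4231 x<b b<c c<a)

rectangular-second-entry : IsPerm (suc m) (a ∷ b ∷ r) → Rectangular (a ∷ b ∷ r) →
                           a ≢ 1 → b ≢ 1 → b ≢ suc a → a ≢ suc b → ⊥
rectangular-second-entry {m} {a} {b} {r} π↭ rect a≢1 b≢1 b≢1+a a≢1+b = gap (<-cmp a b)
  where
  a≢b : a ≢ b
  a≢b with IsPerm-unique π↭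
  ... | (a≢b ∷ _) ∷ _ = a≢b
  bound : x ∈ a ∷ b ∷ r → 1 ≤ x × x ≤ suc m
  bound = IsPerm-∈⁻ π↭
  later : 1 ≤ x → x ≤ suc m → x ≢ a → x ≢ b → x ∈ r
  later 1≤x x≤1+m x≢a x≢b with IsPerm-∈⁺ π↭ 1≤x x≤1+m
  ... | here x≡a          = ⊥-elim (x≢a x≡a)
  ... | there (here x≡b)  = ⊥-elim (x≢b x≡b)
  ... | there (there x∈r) = x∈r
  1∈r : 1 ∈ r
  1∈r = later ≤-refl (s≤s z≤n) (a≢1 ∘ sym) (b≢1 ∘ sym)
  gap : Tri (a < b) (a ≡ b) (b < a) → ⊥
  gap (tri≈ _ a≡b _) = a≢b a≡b
  gap (tri< a<b _ _) = rising-gap-⊥ rect 1∈r 1+a∈r 1<a (n<1+n a) 1+a<b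
    where
    1+a<b = ≤∧≢⇒< a<b (b≢1+a ∘ sym)
    1+a∈r = later (s≤s z≤n) (≤-trans (<⇒≤ 1+a<b) (proj₂ (bound (there (here refl)))))
                  (<⇒≢ (n<1+n a) ∘ sym) (<⇒≢ 1+a<b)
    1<a = ≤∧≢⇒< (proj₁ (bound (here refl))) (a≢1 ∘ sym)
  gap (tri> _ _ b<a) = falling-gap-⊥ rect 1∈r 1+b∈r 1<b (n<1+n b) 1+b<a
    where
    1+b<a = ≤∧≢⇒< b<a (a≢1+b ∘ sym)
    1+b∈r = later (s≤s z≤n) (≤-trans (<⇒≤ 1+b<a) (proj₂ (bound (here refl))))
                  (<⇒≢ 1+b<a) (<⇒≢ (n<1+n b) ∘ sym)
    1<b = ≤∧≢⇒< (proj₁ (bound (there (here refl)))) (b≢1 ∘ sym)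

IsPreimage : ℕ → List ℕ → Psi × List ℕ → Set
IsPreimage m π x = InDomain (proj₁ x) m (proj₂ x) × π ≡ apply (proj₁ x) (proj₂ x)

decompose-ψ₁ : IsPerm (suc m) (1 ∷ r) → Rectangular (1 ∷ r) →
               IsPreimage m (1 ∷ r) (ψ₁ , map (unbump 1) r)
decompose-ψ₁ π↭ rect =
  (tail-unbump-IsPerm π↭ , Rectangular-unbump π↭ (1 ∷ʳ ⊆-refl) rect) , ρ-head π↭ refl

decompose-ψᵤ : IsPerm (suc m) (a ∷ suc a ∷ r) → Rectangular (a ∷ suc a ∷ r) → a ≢ 1 →
               IsPreimage m (a ∷ suc a ∷ r) (ψᵤ , map (unbump a) (suc a ∷ r))
decompose-ψᵤ {a = a} π↭ rect a≢1 =
  ( tail-unbump-IsPerm π↭ , Rectangular-unbump π↭ (a ∷ʳ ⊆-refl) rect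
  , ≤-trans 2≤a (≤-pred (proj₂ (IsPerm-∈⁻ π↭ (there (here refl)))))
  , a≢1 ∘ trans (sym first≡a) )
  , ρ-head π↭ first≡a
  where
  first≡a : unbump a (suc a) ≡ a
  first≡a = unbump-suc ≤-refl
  2≤a : 2 ≤ a
  2≤a = ≤∧≢⇒< (proj₁ (IsPerm-∈⁻ π↭ (here refl))) (a≢1 ∘ sym)

decompose-ψd : IsPerm (suc m) (suc b ∷ b ∷ r) → Rectangular (suc b ∷ b ∷ r) →
               IsPreimage m (suc b ∷ b ∷ r) (ψd , map (unbump (suc b)) (b ∷ r))
decompose-ψd {b = b} π↭ rect =
  ( tail-unbump-IsPerm π↭ , Rectangular-unbump π↭ (suc b ∷ʳ ⊆-refl) rect
  , ≤-trans (proj₁ (IsPerm-∈⁻ π↭ (there (here refl)))) (≤-pred (proj₂ (IsPerm-∈⁻ π↭ (here refl)))) )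
  , ρ-head π↭ (cong suc first≡b)
  where
  first≡b : unbump (suc b) b ≡ b
  first≡b = unbump-< (n<1+n b)

decompose-ψ₂ : IsPerm (suc m) (a ∷ 1 ∷ r) → Rectangular (a ∷ 1 ∷ r) → a ≢ 1 → a ≢ 2 →
               IsPreimage m (a ∷ 1 ∷ r) (ψ₂ , map (unbump 1) (a ∷ r))
decompose-ψ₂ {a = 0} π↭ _ _ _ with () ← proj₁ (IsPerm-∈⁻ π↭ (here refl))
decompose-ψ₂ {a = 1} _ _ a≢1 _ = ⊥-elim (a≢1 refl)
decompose-ψ₂ {a = 2} _ _ _ a≢2 = ⊥-elim (a≢2 refl)
decompose-ψ₂ {a = suc (suc (suc k))} π↭ rect _ _ =
  ( tail-unbump-IsPerm 1∷π↭ , Rectangular-unbump 1∷π↭ (refl ∷ (1 ∷ʳ ⊆-refl)) rect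
  , ≤-trans (s≤s (s≤s z≤n)) (≤-pred (proj₂ (IsPerm-∈⁻ π↭ (here refl)))) , λ () )
  , cong (insertAt 1 1) (sym (tail-bump-unbump 1∷π↭))
  where
  1∷π↭ = ↭-trans (swap 1 _ ↭-refl) π↭

decompose : IsPerm (suc m) π → Rectangular π → ∃ (IsPreimage m π)
decompose {π = []} π↭ _ = ⊥-elim (¬IsPerm-suc-[] π↭)
decompose {π = a ∷ r} π↭ rect with a ≟ 1
... | yes refl = (ψ₁ , _) , decompose-ψ₁ π↭ rect
decompose {π = a ∷ []} π↭ rect | no a≢1 with IsPerm-∈⁺ π↭ ≤-refl (s≤s z≤n)
... | here 1≡a = ⊥-elim (a≢1 (sym 1≡a))
decompose {π = a ∷ b ∷ r} π↭ rect | no a≢1 with b ≟ suc a | a ≟ suc b | b ≟ 1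
... | yes refl | _        | _        = (ψᵤ , _) , decompose-ψᵤ π↭ rect a≢1
... | no _     | yes refl | _        = (ψd , _) , decompose-ψd π↭ rect
... | no _     | no a≢2   | yes refl = (ψ₂ , _) , decompose-ψ₂ π↭ rect a≢1 a≢2
... | no b≢1+a | no a≢1+b | no b≢1   =
  ⊥-elim (rectangular-second-entry π↭ rect a≢1 b≢1 b≢1+a a≢1+b)

-- Only its values on images of the ψ's matter, so the last case is ψ₂ without testing b = 1.
decode : List ℕ → Psi × List ℕ
decode [] = ψ₁ , []
decode (a ∷ r) with a ≟ 1
... | yes _ = ψ₁ , map (unbump 1) r
decode (a ∷ [])    | no _ = ψ₁ , []
decode (a ∷ b ∷ r) | no _ with b ≟ suc a | a ≟ suc b
... | yes _ | _     = ψᵤ , map (unbump a) (b ∷ r)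
... | no _  | yes _ = ψd , map (unbump a) (b ∷ r)
... | no _  | no _  = ψ₂ , map (unbump 1) (a ∷ r)

decode-apply : ∀ ψ {m τ} → InDomain ψ m τ → decode (apply ψ τ) ≡ (ψ , τ)
decode-apply ψ₁ {τ = τ} _ = cong (ψ₁ ,_) (map-unbump-bump 1 τ)
decode-apply ψ₂ {τ = []} (τ↭ , _ , s≤s _ , _) = ⊥-elim (¬IsPerm-suc-[] τ↭)
decode-apply ψ₂ {τ = 0 ∷ _} (τ↭ , _) with () ← proj₁ (IsPerm-∈⁻ τ↭ (here refl))
decode-apply ψ₂ {τ = 1 ∷ _} (_ , _ , _ , s≢1) = ⊥-elim (s≢1 refl)
decode-apply ψ₂ {τ = suc (suc k) ∷ t} _ = cong (λ t → ψ₂ , suc (suc k) ∷ t) (map-unbump-bump 1 t)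
decode-apply ψᵤ {τ = []} (τ↭ , _ , s≤s _ , _) = ⊥-elim (¬IsPerm-suc-[] τ↭)
decode-apply ψᵤ {τ = 0 ∷ _} (τ↭ , _) with () ← proj₁ (IsPerm-∈⁻ τ↭ (here refl))
decode-apply ψᵤ {τ = 1 ∷ _} (_ , _ , _ , s≢1) = ⊥-elim (s≢1 refl)
decode-apply ψᵤ {τ = s@(suc (suc k)) ∷ t} _
  rewrite bump-≥ (≤-refl {s}) | ≟-diag (refl {x = suc s}) =
  cong₂ (λ x t → ψᵤ , x ∷ t) (unbump-suc ≤-refl) (map-unbump-bump s t)
decode-apply ψd {τ = []} (τ↭ , _ , s≤s _) = ⊥-elim (¬IsPerm-suc-[] τ↭)
decode-apply ψd {τ = 0 ∷ _} (τ↭ , _) with () ← proj₁ (IsPerm-∈⁻ τ↭ (here refl))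
decode-apply ψd {τ = s@(suc k) ∷ t} _
  rewrite bump-< (n<1+n s) | dec-no (s ≟ suc (suc s)) (<⇒≢ (m<n⇒m<1+n (n<1+n s)))
        | ≟-diag (refl {x = suc s}) =
  cong₂ (λ x t → ψd , x ∷ t) (unbump-< (n<1+n s)) (map-unbump-bump (suc s) t)

decode-preimage : ∀ {x} → IsPreimage m π x → decode π ≡ x
decode-preimage (dom , refl) = decode-apply _ dom

mainTheorem5 : (m : ℕ) (π : List ℕ) → IsPerm (suc m) π → Rectangular π →
    ∃! _≡_ (λ (p : Psi × List ℕ) →
      InDomain (proj₁ p) m (proj₂ p) × π ≡ apply (proj₁ p) (proj₂ p))
mainTheorem5 m π π↭ rect with x , x-preimage ← decompose π↭ rect =
  x , x-preimage , λ y-preimage → trans (sym (decode-preimage x-preimage)) (decode-preimage y-preimage)
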